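{- For any polymatroid $\mathscr{P}\subseteq\mathbb{N}^p$, $\mathrm{Box}_{\mathscr{P}}(\mathbf{t})=\text{M\"ob}_{\mathscr{P}}(\mathbf{t})$.
   Context: $\mathbb{N}=\{0,1,2,\dots\}$, $[p]=\{1,\dots,p\}$, $\mathbf e_i$ is the $i$th standard basis vector, $|\mathbf n|=n_1+\cdots+n_p$, $\mathbf t^{\mathbf n}=t_1^{n_1}\cdots t_p^{n_p}$. A polymatroid is a finite set $\mathscr{P}\subseteq\mathbb{N}^p$ whose elements all have the same $|\cdot|$ and which is M-convex: for $\mathbf u,\mathbf v\in\mathscr P$ and $i$ with $u_i>v_i$ there is $j$ with $u_j<v_j$ and $\mathbf u-\mathbf e_i+\mathbf e_j\in\mathscr P$. $I(\mathscr P)=(\mathrm{conv}(\mathscr P)+\mathbb R^p_{\le0})\cap\mathbb R^p_{\ge0}$; sums over $\mathbf n\in I(\mathscr P)$ are over $I(\mathscr P)\cap\mathbb N^p$. Box polynomial: $\mathrm{Box}_{\mathscr{P}}(\mathbf{t})=\sum_{\mathbf{n}\in I(\mathscr{P})}\prod_{i=1}^p f_{n_i}(t_i)$, where $f_k(t)=t^k-t^{k-1}$ for $k\ge1$ and $f_0(t)=1$. M\"obius polynomial: $P$ is the poset on $(I(\mathscr P)\cap\mathbb N^p)\sqcup\{\hat1\}$, ordered componentwise with $\hat1$ a new maximum, $\mu_P$ its M\"obius function, $\mu_{\mathscr P}(\mathbf n)=-\mu_P(\mathbf n,\hat1)$, and $\text{M\"ob}_{\mathscr P}(\mathbf t)=\sum_{\mathbf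 n\in I(\mathscr P)}\mu_{\mathscr P}(\mathbf n)\mathbf t^{\mathbf n}$. -}

module Defs where

open import Data.Bool using (Bool; true; false; _∧_; not; if_then_else_)
open import Data.Nat as ℕ using (ℕ; zero; suc; _≤ᵇ_; _<_)
import Data.Nat.Properties as ℕₚ
open import Data.Fin using (Fin)
open import Data.Vec using (Vec; []; _∷_; lookup; updateAt; zipWith; foldr)
import Data.Vec.Properties as Vecₚ
open import Data.List using (List; []; _∷_; length)
open import Data.List.Membership.Propositional using (_∈_)
open import Data.List.Relation.Unary.All using (All)
open import Data.List.Relation.Unary.Unique.Propositional using (Unique)
open import Data.Integer as ℤ using (ℤ; +_; -_)
open import Data.Rational as ℚ using (ℚ)
open import Data.Product using (_×_; _,_; ∃; ∃-syntax; Σ-syntax)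
open import Relation.Nullary.Decidable using (does)
open import Relation.Binary.PropositionalEquality using (_≡_)
open import Function.Bundles using (_⇔_)

∣_∣ᵥ : ∀ {p} → Vec ℕ p → ℕ
∣ v ∣ᵥ = foldr _ ℕ._+_ 0 v

moveUnit : ∀ {p} → Vec ℕ p → Fin p → Fin p → Vec ℕ p
moveUnit u i j = updateAt (updateAt u i ℕ.pred) j suc

-- Polymatroids.  A finite subset of ℕ^p is given by a list (its set of
-- members; repetitions are irrelevant).

SameDegree : ∀ {p} → List (Vec ℕ p) → Set
SameDegree P = ∀ {u v} → u ∈ P → v ∈ P → ∣ u ∣ᵥ ≡ ∣ v ∣ᵥ

MConvex : ∀ {p} → List (Vec ℕ p) → Set
MConvex {p} P =
  ∀ {u v} → u ∈ P → v ∈ P → (i : Fin p) → lookup v i < lookup u i →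
  ∃[ j ] (lookup u j < lookup v j × moveUnit u i j ∈ P)

IsPolymatroid : ∀ {p} → List (Vec ℕ p) → Set
IsPolymatroid P = SameDegree P × MConvex P

-- I(P) ∩ ℕ^p :  n ∈ ℕ^p with n ≤ x componentwise for some x ∈ conv(P).
-- Convex combinations are taken with rational weights.
-- A convex combination is a finite list of (weight, point of P) pairs
-- with nonnegative weights summing to 1.

sumℚ : List ℚ → ℚ
sumℚ [] = ℚ.0ℚ
sumℚ (q ∷ qs) = q ℚ.+ sumℚ qs

weights : ∀ {p} → List (ℚ × Vec ℕ p) → List ℚ
weights [] = []
weights ((q , _) ∷ ws) = q ∷ weights ws

coordComb : ∀ {p} → List (ℚ × Vec ℕ p) → Fin p → ℚ
coordComb [] i = ℚ.0ℚ
coordComb ((q , u) ∷ ws) i = q ℚ.* ((+ lookup u i) ℚ./ 1) ℚ.+ coordComb ws i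

InI : ∀ {p} → List (Vec ℕ p) → Vec ℕ p → Set
InI {p} P n =
  ∃[ ws ] ( All (λ w → ℚ.0ℚ ℚ.≤ Data.Product.proj₁ w × Data.Product.proj₂ w ∈ P) ws
          × sumℚ (weights ws) ≡ ℚ.1ℚ
          × ((i : Fin p) → ((+ lookup n i) ℚ./ 1) ℚ.≤ coordComb ws i) )

Enumerates : ∀ {p} → List (Vec ℕ p) → List (Vec ℕ p) → Set
Enumerates P L = Unique L × (∀ n → (n ∈ L) ⇔ InI P n)

-- Multivariate polynomials in t₁,…,t_p with integer coefficients are
-- represented by their coefficient functions  Vec ℕ p → ℤ
-- (coefficient of the monomial t^m).  Two polynomials are equal iff
-- their coefficient functions agree everywhere.

Poly : ℕ → Set
Poly p = Vec ℕ p → ℤ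

_==_ : ℕ → ℕ → Bool
m == n = does (m ℕ.≟ n)

[_] : Bool → ℤ
[ true ] = + 1
[ false ] = + 0

-- coefficient of t^k in f_n(t)  (f₀ = 1, f_n = t^n - t^(n-1))
fcoef : ℕ → ℕ → ℤ
fcoef zero k = [ k == 0 ]
fcoef (suc n) k = [ k == suc n ] ℤ.- [ k == n ]

prodℤ : ∀ {p} → Vec ℤ p → ℤ
prodℤ = foldr _ ℤ._*_ (+ 1)

-- ∏ᵢ f_{nᵢ}(tᵢ): the variables are distinct, so the coefficient of t^m
-- is ∏ᵢ [t^{mᵢ}] f_{nᵢ}.
prodF : ∀ {p} → Vec ℕ p → Poly p
prodF n m = prodℤ (zipWith fcoef n m)

sumPoly : ∀ {p} {A : Set} → (A → Poly p) → List A → Poly p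
sumPoly f [] m = + 0
sumPoly f (a ∷ as) m = f a m ℤ.+ sumPoly f as m

Box : ∀ {p} → List (Vec ℕ p) → Poly p
Box L = sumPoly prodF L

-- The poset  (I(P) ∩ ℕ^p) ⊔ {1̂}  and its Möbius function.

data Elt (p : ℕ) : Set where
  pt  : Vec ℕ p → Elt p
  top : Elt p

leqV : ∀ {p} → Vec ℕ p → Vec ℕ p → Bool
leqV [] [] = true
leqV (x ∷ xs) (y ∷ ys) = (x ≤ᵇ y) ∧ leqV xs ys

eqV : ∀ {p} → Vec ℕ p → Vec ℕ p → Bool
eqV u v = does (Vecₚ.≡-dec ℕ._≟_ u v)

leqE : ∀ {p} → Elt p → Elt p → Bool
leqE (pt u) (pt v) = leqV u v
leqE (pt u) top = true
leqE top (pt v) = false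
leqE top top = true

eqE : ∀ {p} → Elt p → Elt p → Bool
eqE (pt u) (pt v) = eqV u v
eqE top top = true
eqE _ _ = false

ltE : ∀ {p} → Elt p → Elt p → Bool
ltE x y = leqE x y ∧ not (eqE x y)

elements : ∀ {p} → List (Vec ℕ p) → List (Elt p)
elements [] = top ∷ []
elements (n ∷ ns) = pt n ∷ elements ns

sumℤ : List ℤ → ℤ
sumℤ [] = + 0
sumℤ (z ∷ zs) = z ℤ.+ sumℤ zs

-- The recursion is structural on a fuel argument; fuel = |Q| suffices
-- since each recursive call strictly increases x along a chain in Q.
mobiusFuel : ∀ {p} → ℕ → List (Elt p) → Elt p → Elt p → ℤ
mobiusFuel zero Q x y = + 0
mobiusFuel (suc k) Q x y =
  if eqE x y then + 1
  else if leqE x y then - sumℤ (go Q)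
  else + 0
  where
  go : List (Elt _) → List ℤ
  go [] = []
  go (z ∷ zs) = (if ltE x z ∧ leqE z y then mobiusFuel k Q z y else + 0) ∷ go zs

mobiusP : ∀ {p} → List (Vec ℕ p) → Elt p → Elt p → ℤ
mobiusP L = mobiusFuel (length (elements L)) (elements L)

muPoly : ∀ {p} → List (Vec ℕ p) → Vec ℕ p → ℤ
muPoly L n = - mobiusP L (pt n) top

monomial : ∀ {p} → ℤ → Vec ℕ p → Poly p
monomial c n m = if eqV n m then c else + 0

Mob : ∀ {p} → List (Vec ℕ p) → Poly p
Mob L = sumPoly (λ n → monomial (muPoly L n) n) L

{-# OPTIONS --safe #-}
module Submission where

-- Let h(w) be the coefficient of t^w in Box.  Expanding each ∏ᵢ f_{nᵢ}(tᵢ) into monomials c·t^v,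
-- all with v ≤ n, shows that h vanishes outside the down-closed set I = I(𝒫) ∩ ℕ^p and that
-- Σ_{w ∈ I, w ≥ x} h(w) = Σ_{n ∈ I} [x = n] = 1 for every x ∈ I: in each variable
-- Σ_{w ≥ x} [t^w] f_n(t) telescopes to [x = n].  These upper sums also characterise μ_𝒫, since
-- the Möbius recursion for μ_P(·, 1̂) says exactly Σ_{w ∈ I, w ≥ x} μ_𝒫(w) = 1; induction on the
-- number of strict upper bounds of x gives μ_𝒫 = h on I.  Only the down-closedness of I(𝒫) is
-- used, not the exchange property of 𝒫.

open import Defs
open import Data.Nat using (ℕ)
open import Data.Vec using (Vec)
open import Data.List using (List)
open import Relation.Binary.PropositionalEquality using (_≡_)

import Algebra.Properties.CommutativeSemigroup as CommutativeSemigroupProperties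
open import Data.Bool using (Bool; true; false; T; _∧_; not; if_then_else_)
open import Data.Bool.Properties using (T-∧; T-≡; T-not-≡)
open import Data.Empty using (⊥-elim)
open import Data.Integer as ℤ using (ℤ; +_; -_; _+_; _*_; _-_)
import Data.Integer.Properties as ℤₚ
open import Data.List using ([]; _∷_; _++_; map; length; cartesianProductWith)
open import Data.List.Membership.Propositional using (_∈_; _∉_)
open import Data.List.Membership.Propositional.Properties using (∈-cartesianProductWith⁻)
open import Data.List.Properties using (foldr-universal; map-is-foldr)
import Data.List.Relation.Unary.All as All
open import Data.List.Relation.Unary.AllPairs using (_∷_)
open import Data.List.Relation.Unary.Any using (here; there; any?)
open import Data.List.Relation.Unary.Unique.Propositional using (Unique)
open import Data.Nat as ℕ using (zero; suc; _≤ᵇ_; z≤n)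
import Data.Nat.Coprimality as Coprimality
import Data.Nat.Properties as ℕₚ
open import Data.Product using (_×_; _,_; proj₁; proj₂)
open import Data.Rational as ℚ using (mkℚ)
import Data.Rational.Properties as ℚₚ
open import Data.Vec using ([]; _∷_; zipWith)
import Data.Vec.Properties as Vecₚ
open import Data.Vec.Relation.Binary.Pointwise.Inductive as Pointwise using (Pointwise; []; _∷_)
open import Function using (_∘_; _⇔_; mk⇔; Equivalence)
open import Relation.Binary.PropositionalEquality
  using (refl; sym; trans; cong; cong₂; subst; subst₂; _≢_; module ≡-Reasoning)
open import Relation.Nullary using (¬_; Dec; yes; no)
open import Relation.Nullary.Decidable using (dec-true; dec-false)

open CommutativeSemigroupProperties ℤₚ.*-commutativeSemigroup using (interchange; x∙yz≈y∙zx)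
open CommutativeSemigroupProperties ℤₚ.+-commutativeSemigroup using () renaming (interchange to +-interchange)
open ≡-Reasoning

private
  variable
    A B C : Set
    p     : ℕ

∑ : List A → (A → ℤ) → ℤ
∑ []       f = + 0
∑ (a ∷ as) f = f a + ∑ as f

∑-cong : (xs : List A) {f g : A → ℤ} → (∀ {a} → a ∈ xs → f a ≡ g a) → ∑ xs f ≡ ∑ xs g
∑-cong []       f≗g = refl
∑-cong (a ∷ xs) f≗g = cong₂ _+_ (f≗g (here refl)) (∑-cong xs (f≗g ∘ there))

∑-zero : (xs : List A) → ∑ xs (λ _ → + 0) ≡ + 0
∑-zero []       = refl
∑-zero (a ∷ xs) = trans (ℤₚ.+-identityˡ _) (∑-zero xs)

∑-++ : (xs ys : List A) (f : A → ℤ) → ∑ (xs ++ ys) f ≡ ∑ xs f + ∑ ys f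
∑-++ []       ys f = sym (ℤₚ.+-identityˡ _)
∑-++ (x ∷ xs) ys f = trans (cong (_+_ (f x)) (∑-++ xs ys f)) (sym (ℤₚ.+-assoc (f x) _ _))

∑-*ˡ : (c : ℤ) (xs : List A) (f : A → ℤ) → ∑ xs (λ a → c * f a) ≡ c * ∑ xs f
∑-*ˡ c []       f = sym (ℤₚ.*-zeroʳ c)
∑-*ˡ c (x ∷ xs) f = trans (cong (_+_ (c * f x)) (∑-*ˡ c xs f)) (sym (ℤₚ.*-distribˡ-+ c (f x) _))

∑-*ʳ : (c : ℤ) (xs : List A) (f : A → ℤ) → ∑ xs (λ a → f a * c) ≡ ∑ xs f * c
∑-*ʳ c xs f = begin
  ∑ xs (λ a → f a * c) ≡⟨ ∑-cong xs (λ {a} _ → ℤₚ.*-comm (f a) c) ⟩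
  ∑ xs (λ a → c * f a) ≡⟨ ∑-*ˡ c xs f ⟩
  c * ∑ xs f           ≡⟨ ℤₚ.*-comm c _ ⟩
  ∑ xs f * c           ∎

∑-+ : (xs : List A) (f g : A → ℤ) → ∑ xs (λ a → f a + g a) ≡ ∑ xs f + ∑ xs g
∑-+ []       f g = refl
∑-+ (x ∷ xs) f g = trans (cong (_+_ (f x + g x)) (∑-+ xs f g)) (+-interchange (f x) (g x) _ _)

∑-neg : (xs : List A) (f : A → ℤ) → ∑ xs (λ a → - f a) ≡ - ∑ xs f
∑-neg []       f = refl
∑-neg (x ∷ xs) f = trans (cong (_+_ (- f x)) (∑-neg xs f)) (sym (ℤₚ.neg-distrib-+ (f x) _))

∑-comm : (xs : List A) (ys : List B) (f : A → B → ℤ) →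
         ∑ xs (λ a → ∑ ys (f a)) ≡ ∑ ys (λ b → ∑ xs (λ a → f a b))
∑-comm []       ys f = sym (∑-zero ys)
∑-comm (x ∷ xs) ys f = trans (cong (_+_ (∑ ys (f x))) (∑-comm xs ys f))
                             (sym (∑-+ ys (f x) (λ b → ∑ xs (λ a → f a b))))

∑-map : (g : A → B) (xs : List A) (f : B → ℤ) → ∑ (map g xs) f ≡ ∑ xs (f ∘ g)
∑-map g []       f = refl
∑-map g (x ∷ xs) f = cong (_+_ (f (g x))) (∑-map g xs f)

∑-cartesianProductWith : (g : A → B → C) (xs : List A) (ys : List B) (f : C → ℤ) →
  ∑ (cartesianProductWith g xs ys) f ≡ ∑ xs (λ a → ∑ ys (λ b → f (g a b)))
∑-cartesianProductWith g []       ys f = refl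
∑-cartesianProductWith g (x ∷ xs) ys f = begin
  ∑ (map (g x) ys ++ cartesianProductWith g xs ys) f
    ≡⟨ ∑-++ (map (g x) ys) _ f ⟩
  ∑ (map (g x) ys) f + ∑ (cartesianProductWith g xs ys) f
    ≡⟨ cong₂ _+_ (∑-map (g x) ys f) (∑-cartesianProductWith g xs ys f) ⟩
  ∑ ys (λ b → f (g x b)) + ∑ xs (λ a → ∑ ys (λ b → f (g a b))) ∎

[∧] : ∀ x y → [ x ∧ y ] ≡ [ x ] * [ y ]
[∧] true  y = sym (ℤₚ.*-identityˡ [ y ])
[∧] false y = refl

[]-split : ∀ b e → (T e → T b) → [ b ] ≡ [ b ∧ not e ] + [ e ]
[]-split true  true  _   = refl
[]-split true  false _   = refl
[]-split false true  e⇒b = ⊥-elim (e⇒b _)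
[]-split false false _   = refl

if-then-else≡[]* : ∀ b (c : ℤ) → (if b then c else + 0) ≡ [ b ] * c
if-then-else≡[]* true  c = sym (ℤₚ.*-identityˡ c)
if-then-else≡[]* false c = refl

_≤ᵥ_ : Vec ℕ p → Vec ℕ p → Set
_≤ᵥ_ = Pointwise ℕ._≤_

leqV⇔≤ᵥ : (u v : Vec ℕ p) → T (leqV u v) ⇔ u ≤ᵥ v
leqV⇔≤ᵥ []      []      = mk⇔ (λ _ → []) (λ _ → _)
leqV⇔≤ᵥ (a ∷ u) (b ∷ v) = mk⇔
  (λ t → let a≤ᵇb , u≤v = Equivalence.to T-∧ t in
         ℕₚ.≤ᵇ⇒≤ a b a≤ᵇb ∷ Equivalence.to (leqV⇔≤ᵥ u v) u≤v)
  (λ { (a≤b ∷ u≤v) → Equivalence.from T-∧ (ℕₚ.≤⇒≤ᵇ a≤b , Equivalence.from (leqV⇔≤ᵥ u v) u≤v) })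

leqV-refl : (u : Vec ℕ p) → T (leqV u u)
leqV-refl u = Equivalence.from (leqV⇔≤ᵥ u u) (Pointwise.refl ℕₚ.≤-refl)

≤ᵥ-antisym : {u v : Vec ℕ p} → u ≤ᵥ v → v ≤ᵥ u → u ≡ v
≤ᵥ-antisym []          []          = refl
≤ᵥ-antisym (a≤b ∷ u≤v) (b≤a ∷ v≤u) = cong₂ _∷_ (ℕₚ.≤-antisym a≤b b≤a) (≤ᵥ-antisym u≤v v≤u)

eqV-≡ : (u : Vec ℕ p) → eqV u u ≡ true
eqV-≡ u = dec-true (Vecₚ.≡-dec ℕ._≟_ u u) refl

eqV-≢ : {u v : Vec ℕ p} → u ≢ v → eqV u v ≡ false
eqV-≢ {u = u} {v} = dec-false (Vecₚ.≡-dec ℕ._≟_ u v)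

eqV⇒≡ : (u v : Vec ℕ p) → T (eqV u v) → u ≡ v
eqV⇒≡ u v t with Vecₚ.≡-dec ℕ._≟_ u v
... | yes u≡v = u≡v
... | no  _   = ⊥-elim t

eqV-comm : (u v : Vec ℕ p) → eqV u v ≡ eqV v u
eqV-comm u v with Vecₚ.≡-dec ℕ._≟_ u v
... | yes refl = sym (eqV-≡ u)
... | no  u≢v  = sym (eqV-≢ (u≢v ∘ sym))

ltV : Vec ℕ p → Vec ℕ p → Bool
ltV u v = leqV u v ∧ not (eqV u v)

ltV-sound : (u v : Vec ℕ p) → T (ltV u v) → u ≤ᵥ v × u ≢ v
ltV-sound u v t = let u≤v , u≢v = Equivalence.to T-∧ t in
  Equivalence.to (leqV⇔≤ᵥ u v) u≤v , λ { refl → subst (T ∘ not) (eqV-≡ u) u≢v }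

ltV-complete : (u v : Vec ℕ p) → u ≤ᵥ v → u ≢ v → T (ltV u v)
ltV-complete u v u≤v u≢v =
  Equivalence.from T-∧ (Equivalence.from (leqV⇔≤ᵥ u v) u≤v , Equivalence.from T-not-≡ (eqV-≢ u≢v))

ltV-irrefl : (u : Vec ℕ p) → ¬ T (ltV u u)
ltV-irrefl u t = proj₂ (ltV-sound u u t) refl

ltV-trans : (u v w : Vec ℕ p) → T (ltV u v) → T (ltV v w) → T (ltV u w)
ltV-trans u v w u<v v<w with ltV-sound u v u<v | ltV-sound v w v<w
... | u≤v , u≢v | v≤w , _ =
  ltV-complete u w (Pointwise.trans ℕₚ.≤-trans u≤v v≤w) λ { refl → u≢v (≤ᵥ-antisym u≤v v≤w) }

[eqV]≡∏ : (u v : Vec ℕ p) → [ eqV u v ] ≡ prodℤ (zipWith (λ a b → [ a == b ]) u v)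
[eqV]≡∏ []      []      = refl
[eqV]≡∏ (a ∷ u) (b ∷ v) = trans ([∧] (a == b) (eqV u v)) (cong ([ a == b ] *_) ([eqV]≡∏ u v))

[leqV]≡∏ : (u v : Vec ℕ p) → [ leqV u v ] ≡ prodℤ (zipWith (λ a b → [ a ≤ᵇ b ]) u v)
[leqV]≡∏ []      []      = refl
[leqV]≡∏ (a ∷ u) (b ∷ v) = trans ([∧] (a ≤ᵇ b) (leqV u v)) (cong ([ a ≤ᵇ b ] *_) ([leqV]≡∏ u v))

∑-[eqV]-∉ : {v : Vec ℕ p} (xs : List (Vec ℕ p)) (G : Vec ℕ p → ℤ) → v ∉ xs →
            ∑ xs (λ w → [ eqV w v ] * G w) ≡ + 0
∑-[eqV]-∉ []       G v∉ = refl
∑-[eqV]-∉ (x ∷ xs) G v∉ =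
  cong₂ (λ b s → [ b ] * G x + s) (eqV-≢ (v∉ ∘ here ∘ sym)) (∑-[eqV]-∉ xs G (v∉ ∘ there))

∑-[eqV]-∈ : {v : Vec ℕ p} {xs : List (Vec ℕ p)} (G : Vec ℕ p → ℤ) → Unique xs → v ∈ xs →
            ∑ xs (λ w → [ eqV w v ] * G w) ≡ G v
∑-[eqV]-∈ {v = v} {_ ∷ xs} G (v≢ ∷ _) (here refl) = begin
  [ eqV v v ] * G v + ∑ xs (λ w → [ eqV w v ] * G w)
    ≡⟨ cong₂ (λ b s → [ b ] * G v + s) (eqV-≡ v) (∑-[eqV]-∉ xs G (λ v∈ → All.lookup v≢ v∈ refl)) ⟩
  + 1 * G v + + 0
    ≡⟨ trans (ℤₚ.+-identityʳ _) (ℤₚ.*-identityˡ _) ⟩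
  G v ∎
∑-[eqV]-∈ {xs = x ∷ _} G (x≢ ∷ unique) (there v∈) =
  trans (cong (λ b → [ b ] * G x + _) (eqV-≢ (All.lookup x≢ v∈)))
        (trans (ℤₚ.+-identityˡ _) (∑-[eqV]-∈ G unique v∈))

fTerms : ℕ → List (ℤ × ℕ)
fTerms zero    = (+ 1 , 0) ∷ []
fTerms (suc a) = (+ 1 , suc a) ∷ (- + 1 , a) ∷ []

prodFTerms : Vec ℕ p → List (ℤ × Vec ℕ p)
prodFTerms []      = (+ 1 , []) ∷ []
prodFTerms (a ∷ n) = cartesianProductWith (λ (c , e) (d , v) → c * d , e ∷ v) (fTerms a) (prodFTerms n)

fTerms-≤ : ∀ a {c e} → (c , e) ∈ fTerms a → e ℕ.≤ a
fTerms-≤ zero    (here refl)         = z≤n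
fTerms-≤ (suc a) (here refl)         = ℕₚ.≤-refl
fTerms-≤ (suc a) (there (here refl)) = ℕₚ.n≤1+n a

prodFTerms-≤ᵥ : (n : Vec ℕ p) {c : ℤ} {v : Vec ℕ p} → (c , v) ∈ prodFTerms n → v ≤ᵥ n
prodFTerms-≤ᵥ []      (here refl) = []
prodFTerms-≤ᵥ (a ∷ n) t∈ with ∈-cartesianProductWith⁻ _ (fTerms a) (prodFTerms n) t∈
... | _ , _ , ce∈ , dv∈ , refl = fTerms-≤ a ce∈ ∷ prodFTerms-≤ᵥ n dv∈

∑-fTerms-zero : (g : ℕ → ℤ) → ∑ (fTerms 0) (λ (c , e) → c * g e) ≡ g 0
∑-fTerms-zero g = trans (ℤₚ.+-identityʳ _) (ℤₚ.*-identityˡ (g 0))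

∑-fTerms-suc : ∀ a (g : ℕ → ℤ) → ∑ (fTerms (suc a)) (λ (c , e) → c * g e) ≡ g (suc a) - g a
∑-fTerms-suc a g = cong₂ _+_ (ℤₚ.*-identityˡ (g (suc a))) (trans (ℤₚ.+-identityʳ _) (ℤₚ.-1*i≡-i (g a)))

∑-prodFTerms-∏ : (ψ Ψ : ℕ → ℕ → ℤ) → (∀ a b → ∑ (fTerms a) (λ (c , e) → c * ψ b e) ≡ Ψ a b) →
  (n u : Vec ℕ p) → ∑ (prodFTerms n) (λ (c , v) → c * prodℤ (zipWith ψ u v)) ≡ prodℤ (zipWith Ψ n u)
∑-prodFTerms-∏ ψ Ψ fTerms-Ψ []      []      = refl
∑-prodFTerms-∏ ψ Ψ fTerms-Ψ (a ∷ n) (b ∷ u) = begin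
  ∑ (cartesianProductWith _ (fTerms a) (prodFTerms n)) (λ (c , v) → c * prodℤ (zipWith ψ (b ∷ u) v))
    ≡⟨ ∑-cartesianProductWith _ (fTerms a) (prodFTerms n) _ ⟩
  ∑ (fTerms a) (λ (c , e) → ∑ (prodFTerms n) (λ (d , v) → c * d * (ψ b e * Π v)))
    ≡⟨ ∑-cong (fTerms a) (λ {(c , e)} _ →
         ∑-cong (prodFTerms n) (λ {(d , v)} _ → interchange c d (ψ b e) (Π v))) ⟩
  ∑ (fTerms a) (λ (c , e) → ∑ (prodFTerms n) (λ (d , v) → c * ψ b e * (d * Π v)))
    ≡⟨ ∑-cong (fTerms a) (λ {(c , e)} _ → ∑-*ˡ (c * ψ b e) (prodFTerms n) _) ⟩
  ∑ (fTerms a) (λ (c , e) → c * ψ b e * ∑ (prodFTerms n) (λ (d , v) → d * Π v))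
    ≡⟨ ∑-*ʳ _ (fTerms a) _ ⟩
  ∑ (fTerms a) (λ (c , e) → c * ψ b e) * ∑ (prodFTerms n) (λ (d , v) → d * Π v)
    ≡⟨ cong₂ _*_ (fTerms-Ψ a b) (∑-prodFTerms-∏ ψ Ψ fTerms-Ψ n u) ⟩
  Ψ a b * prodℤ (zipWith Ψ n u) ∎
  where
  Π : Vec ℕ _ → ℤ
  Π v = prodℤ (zipWith ψ u v)

prodF≡∑-prodFTerms : (n w : Vec ℕ p) → prodF n w ≡ ∑ (prodFTerms n) (λ (c , v) → c * [ eqV w v ])
prodF≡∑-prodFTerms n w = sym (begin
  ∑ (prodFTerms n) (λ (c , v) → c * [ eqV w v ])
    ≡⟨ ∑-cong (prodFTerms n) (λ {(c , v)} _ → cong (c *_) ([eqV]≡∏ w v)) ⟩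
  ∑ (prodFTerms n) (λ (c , v) → c * prodℤ (zipWith (λ a b → [ a == b ]) w v))
    ≡⟨ ∑-prodFTerms-∏ (λ a b → [ a == b ]) fcoef fTerms-fcoef n w ⟩
  prodF n w ∎)
  where
  fTerms-fcoef : ∀ a b → ∑ (fTerms a) (λ (c , e) → c * [ b == e ]) ≡ fcoef a b
  fTerms-fcoef zero    b = ∑-fTerms-zero (λ e → [ b == e ])
  fTerms-fcoef (suc a) b = ∑-fTerms-suc a (λ e → [ b == e ])

∑-prodFTerms-[leqV] : (n x : Vec ℕ p) → ∑ (prodFTerms n) (λ (c , v) → c * [ leqV x v ]) ≡ [ eqV n x ]
∑-prodFTerms-[leqV] n x = begin
  ∑ (prodFTerms n) (λ (c , v) → c * [ leqV x v ])
    ≡⟨ ∑-cong (prodFTerms n) (λ {(c , v)} _ → cong (c *_) ([leqV]≡∏ x v)) ⟩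
  ∑ (prodFTerms n) (λ (c , v) → c * prodℤ (zipWith (λ a b → [ a ≤ᵇ b ]) x v))
    ≡⟨ ∑-prodFTerms-∏ (λ a b → [ a ≤ᵇ b ]) (λ a b → [ a == b ]) fTerms-≤ᵇ n x ⟩
  prodℤ (zipWith (λ a b → [ a == b ]) n x)
    ≡⟨ sym ([eqV]≡∏ n x) ⟩
  [ eqV n x ] ∎
  where
  ≤ᵇ-suc : ∀ m k → (suc m ≤ᵇ suc k) ≡ (m ≤ᵇ k)
  ≤ᵇ-suc zero    k = refl
  ≤ᵇ-suc (suc m) k = refl

  [≤ᵇ-suc]-[≤ᵇ] : ∀ a b → [ b ≤ᵇ suc a ] - [ b ≤ᵇ a ] ≡ [ suc a == b ]
  [≤ᵇ-suc]-[≤ᵇ] a       zero          = refl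
  [≤ᵇ-suc]-[≤ᵇ] zero    (suc zero)    = refl
  [≤ᵇ-suc]-[≤ᵇ] zero    (suc (suc b)) = refl
  [≤ᵇ-suc]-[≤ᵇ] (suc a) (suc b)       =
    trans (cong₂ (λ s t → [ s ] - [ t ]) (≤ᵇ-suc b (suc a)) (≤ᵇ-suc b a)) ([≤ᵇ-suc]-[≤ᵇ] a b)

  fTerms-≤ᵇ : ∀ a b → ∑ (fTerms a) (λ (c , e) → c * [ b ≤ᵇ e ]) ≡ [ a == b ]
  fTerms-≤ᵇ zero    zero    = refl
  fTerms-≤ᵇ zero    (suc b) = refl
  fTerms-≤ᵇ (suc a) b       = trans (∑-fTerms-suc a (λ e → [ b ≤ᵇ e ])) ([≤ᵇ-suc]-[≤ᵇ] a b)

DownClosed : List (Vec ℕ p) → Set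
DownClosed L = ∀ {n w} → n ∈ L → w ≤ᵥ n → w ∈ L

fromℕ-mono-≤ : ∀ {a b} → a ℕ.≤ b → (+ a ℚ./ 1) ℚ.≤ (+ b ℚ./ 1)
fromℕ-mono-≤ {a} {b} a≤b = subst₂ ℚ._≤_ (sym (a/1≡ a)) (sym (a/1≡ b))
  (ℚ.*≤* (subst₂ ℤ._≤_ (sym (ℤₚ.*-identityʳ (+ a))) (sym (ℤₚ.*-identityʳ (+ b))) (ℤ.+≤+ a≤b)))
  where
  a/1≡ : ∀ a → + a ℚ./ 1 ≡ mkℚ (+ a) 0 (Coprimality.sym (Coprimality.1-coprimeTo a))
  a/1≡ a = ℚₚ.normalize-coprime (Coprimality.sym (Coprimality.1-coprimeTo a))

InI-≤ᵥ : {P : List (Vec ℕ p)} {n w : Vec ℕ p} → InI P n → w ≤ᵥ n → InI P w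
InI-≤ᵥ (ws , convex , total , n≤ws) w≤n =
  ws , convex , total , λ i → ℚₚ.≤-trans (fromℕ-mono-≤ (Pointwise.lookup w≤n i)) (n≤ws i)

Enumerates⇒DownClosed : {P L : List (Vec ℕ p)} → Enumerates P L → DownClosed L
Enumerates⇒DownClosed (_ , ∈L⇔InI) {n} {w} n∈L w≤n =
  Equivalence.from (∈L⇔InI w) (InI-≤ᵥ (Equivalence.to (∈L⇔InI n) n∈L) w≤n)

sumPoly≡∑ : (f : A → Poly p) (xs : List A) (m : Vec ℕ p) → sumPoly f xs m ≡ ∑ xs (λ a → f a m)
sumPoly≡∑ f []       m = refl
sumPoly≡∑ f (a ∷ xs) m = cong (_+_ (f a m)) (sumPoly≡∑ f xs m)

module _ {L : List (Vec ℕ p)} (unique : Unique L) (closed : DownClosed L) where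

  private
    prodFTerms⊆ : ∀ {n c v} → n ∈ L → (c , v) ∈ prodFTerms n → v ∈ L
    prodFTerms⊆ {n} n∈L cv∈ = closed n∈L (prodFTerms-≤ᵥ n cv∈)

  ∑-*prodF : (G : Vec ℕ p → ℤ) {n : Vec ℕ p} → n ∈ L →
             ∑ L (λ w → G w * prodF n w) ≡ ∑ (prodFTerms n) (λ (c , v) → c * G v)
  ∑-*prodF G {n} n∈L = begin
    ∑ L (λ w → G w * prodF n w)
      ≡⟨ ∑-cong L (λ {w} _ → trans (cong (G w *_) (prodF≡∑-prodFTerms n w))
                                   (sym (∑-*ˡ (G w) (prodFTerms n) _))) ⟩
    ∑ L (λ w → ∑ (prodFTerms n) (λ (c , v) → G w * (c * [ eqV w v ])))
      ≡⟨ ∑-comm L (prodFTerms n) _ ⟩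
    ∑ (prodFTerms n) (λ (c , v) → ∑ L (λ w → G w * (c * [ eqV w v ])))
      ≡⟨ ∑-cong (prodFTerms n) (λ {(c , v)} _ →
           trans (∑-cong L (λ {w} _ → x∙yz≈y∙zx (G w) c _)) (∑-*ˡ c L _)) ⟩
    ∑ (prodFTerms n) (λ (c , v) → c * ∑ L (λ w → [ eqV w v ] * G w))
      ≡⟨ ∑-cong (prodFTerms n) (λ {(c , v)} cv∈ →
           cong (c *_) (∑-[eqV]-∈ G unique (prodFTerms⊆ n∈L cv∈))) ⟩
    ∑ (prodFTerms n) (λ (c , v) → c * G v) ∎

  Box-∉ : {w : Vec ℕ p} → w ∉ L → Box L w ≡ + 0
  Box-∉ {w} w∉L = begin
    Box L w                ≡⟨ sumPoly≡∑ prodF L w ⟩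
    ∑ L (λ n → prodF n w)  ≡⟨ ∑-cong L (λ {n} n∈L → trans (prodF≡∑-prodFTerms n w) (vanish n∈L)) ⟩
    ∑ L (λ _ → + 0)        ≡⟨ ∑-zero L ⟩
    + 0                    ∎
    where
    vanish : ∀ {n} → n ∈ L → ∑ (prodFTerms n) (λ (c , v) → c * [ eqV w v ]) ≡ + 0
    vanish {n} n∈L = trans (∑-cong (prodFTerms n) term≡0) (∑-zero (prodFTerms n))
      where
      term≡0 : ∀ {(c , v) : ℤ × Vec ℕ p} → (c , v) ∈ prodFTerms n → c * [ eqV w v ] ≡ + 0
      term≡0 {c , v} cv∈ = trans (cong (λ b → c * [ b ]) (eqV-≢ {u = w} {v} w≢v)) (ℤₚ.*-zeroʳ c)
        where
        w≢v : w ≢ v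
        w≢v refl = w∉L (prodFTerms⊆ n∈L cv∈)

  ∑-upper-Box : {x : Vec ℕ p} → x ∈ L → ∑ L (λ w → [ leqV x w ] * Box L w) ≡ + 1
  ∑-upper-Box {x} x∈L = begin
    ∑ L (λ w → [ leqV x w ] * Box L w)
      ≡⟨ ∑-cong L (λ {w} _ → trans (cong ([ leqV x w ] *_) (sumPoly≡∑ prodF L w))
                                   (sym (∑-*ˡ [ leqV x w ] L (λ n → prodF n w)))) ⟩
    ∑ L (λ w → ∑ L (λ n → [ leqV x w ] * prodF n w))
      ≡⟨ ∑-comm L L _ ⟩
    ∑ L (λ n → ∑ L (λ w → [ leqV x w ] * prodF n w))
      ≡⟨ ∑-cong L (λ {n} n∈L →
           trans (∑-*prodF (λ w → [ leqV x w ]) n∈L) (∑-prodFTerms-[leqV] n x)) ⟩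
    ∑ L (λ n → [ eqV n x ])
      ≡⟨ ∑-cong L (λ _ → sym (ℤₚ.*-identityʳ _)) ⟩
    ∑ L (λ n → [ eqV n x ] * + 1)
      ≡⟨ ∑-[eqV]-∈ (λ _ → + 1) unique x∈L ⟩
    + 1 ∎

mobiusStep : ℕ → List (Elt p) → Elt p → Elt p → Elt p → ℤ
mobiusStep k Q x y z = if ltE x z ∧ leqE z y then mobiusFuel k Q z y else + 0

-- The summands of mobiusFuel come from a local function of Defs that cannot be named here.
-- Abstracting the element list, its tail and sumℤ makes that function appear applied to a
-- fresh variable, so foldr-universal can identify it from its defining equations.
mobiusFuel-unfold : ∀ k (L : List (Vec ℕ p)) v →
  let Q = elements L in mobiusFuel (suc k) Q (pt v) top ≡ - sumℤ (map (mobiusStep k Q (pt v) top) Q)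
mobiusFuel-unfold k []      v = refl
mobiusFuel-unfold k (n ∷ L) v with elements (n ∷ L)
... | Q with elements L | sumℤ
           | foldr-universal _ (λ z zs → mobiusStep k Q (pt v) top z ∷ zs) [] refl (λ _ _ → refl)
... | R | sum | go≗foldr =
  cong (λ zs → - (mobiusStep k Q (pt v) top (pt n) + sum zs)) (trans (go≗foldr R) (sym (map-is-foldr R)))

sumℤ-map : (f : A → ℤ) (xs : List A) → sumℤ (map f xs) ≡ ∑ xs f
sumℤ-map f []       = refl
sumℤ-map f (x ∷ xs) = cong (_+_ (f x)) (sumℤ-map f xs)

∑-elements : (xs : List (Vec ℕ p)) (f : Elt p → ℤ) → ∑ (elements xs) f ≡ ∑ xs (f ∘ pt) + f top
∑-elements []       f = trans (ℤₚ.+-identityʳ (f top)) (sym (ℤₚ.+-identityˡ (f top)))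
∑-elements (x ∷ xs) f = trans (cong (_+_ (f (pt x))) (∑-elements xs f)) (sym (ℤₚ.+-assoc (f (pt x)) _ _))

length-elements : (xs : List (Vec ℕ p)) → length (elements xs) ≡ suc (length xs)
length-elements []       = refl
length-elements (x ∷ xs) = cong suc (length-elements xs)

count : (A → Bool) → List A → ℕ
count P []       = 0
count P (a ∷ xs) = if P a then suc (count P xs) else count P xs

count-mono : (P Q : A → Bool) → (∀ a → T (P a) → T (Q a)) → (xs : List A) → count P xs ℕ.≤ count Q xs
count-mono P Q P⇒Q []       = z≤n
count-mono P Q P⇒Q (a ∷ xs) with P a | Q a | P⇒Q a
... | true  | true  | _   = ℕ.s≤s (count-mono P Q P⇒Q xs)
... | true  | false | P⇒Q = ⊥-elim (P⇒Q _)
... | false | true  | _   = ℕₚ.m≤n⇒m≤1+n (count-mono P Q P⇒Q xs)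
... | false | false | _   = count-mono P Q P⇒Q xs

count-< : (P Q : A → Bool) → (∀ a → T (P a) → T (Q a)) → {a : A} {xs : List A} →
          a ∈ xs → T (Q a) → ¬ T (P a) → count P xs ℕ.< count Q xs
count-< P Q P⇒Q {xs = a ∷ xs} (here refl) Qa ¬Pa with P a | Q a
... | true  | _     = ⊥-elim (¬Pa _)
... | false | true  = ℕ.s≤s (count-mono P Q P⇒Q xs)
count-< P Q P⇒Q {xs = b ∷ xs} (there a∈) Qa ¬Pa with P b | Q b | P⇒Q b
... | true  | true  | _   = ℕ.s≤s (count-< P Q P⇒Q a∈ Qa ¬Pa)
... | true  | false | P⇒Q = ⊥-elim (P⇒Q _)
... | false | true  | _   = ℕₚ.m<n⇒m<1+n (count-< P Q P⇒Q a∈ Qa ¬Pa)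
... | false | false | _   = count-< P Q P⇒Q a∈ Qa ¬Pa

count-true : (xs : List A) → count (λ _ → true) xs ≡ length xs
count-true []       = refl
count-true (_ ∷ xs) = cong suc (count-true xs)

module _ {L : List (Vec ℕ p)} (unique : Unique L) (ν : Vec ℕ p → ℤ)
         (∑-upper-ν : ∀ {x} → x ∈ L → ∑ L (λ w → [ leqV x w ] * ν w) ≡ + 1) where

  ∑-strictUpper-ν : {x : Vec ℕ p} → x ∈ L → ∑ L (λ w → [ ltV x w ] * ν w) + ν x ≡ + 1
  ∑-strictUpper-ν {x} x∈L = begin
    ∑ L (λ w → [ ltV x w ] * ν w) + ν x
      ≡⟨ cong (_+_ (∑ L (λ w → [ ltV x w ] * ν w))) (sym (∑-[eqV]-∈ ν unique x∈L)) ⟩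
    ∑ L (λ w → [ ltV x w ] * ν w) + ∑ L (λ w → [ eqV w x ] * ν w)
      ≡⟨ sym (∑-+ L _ _) ⟩
    ∑ L (λ w → [ ltV x w ] * ν w + [ eqV w x ] * ν w)
      ≡⟨ ∑-cong L (λ {w} _ → trans (sym (ℤₚ.*-distribʳ-+ (ν w) [ ltV x w ] [ eqV w x ]))
                                   (cong (_* ν w) (sym (split w)))) ⟩
    ∑ L (λ w → [ leqV x w ] * ν w)
      ≡⟨ ∑-upper-ν x∈L ⟩
    + 1 ∎
    where
    split : ∀ w → [ leqV x w ] ≡ [ ltV x w ] + [ eqV w x ]
    split w = trans ([]-split (leqV x w) (eqV x w) x≡w⇒x≤w)
                    (cong (λ b → [ ltV x w ] + [ b ]) (eqV-comm x w))
      where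
      x≡w⇒x≤w : T (eqV x w) → T (leqV x w)
      x≡w⇒x≤w t = subst (T ∘ leqV x) (eqV⇒≡ x w t) (leqV-refl x)

  private
    Q : List (Elt p)
    Q = elements L

  mobiusFuel-top : ∀ k {x} → x ∈ L → count (ltV x) L ℕ.< k → mobiusFuel (suc k) Q (pt x) top ≡ - ν x
  mobiusFuel-top zero    x∈L ()
  mobiusFuel-top (suc k) {x} x∈L bound = begin
    mobiusFuel (suc (suc k)) Q (pt x) top
      ≡⟨ mobiusFuel-unfold (suc k) L x ⟩
    - sumℤ (map step Q)
      ≡⟨ cong -_ (trans (sumℤ-map step Q) (∑-elements L step)) ⟩
    - (∑ L (λ w → step (pt w)) + + 1)
      ≡⟨ cong (λ s → - (s + + 1)) (∑-cong L step-pt) ⟩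
    - (∑ L (λ w → - ([ ltV x w ] * ν w)) + + 1)
      ≡⟨ cong (λ s → - (s + + 1)) (∑-neg L _) ⟩
    - (- S + + 1)
      ≡⟨ cong (λ s → - (- S + s)) (sym (∑-strictUpper-ν x∈L)) ⟩
    - (- S + (S + ν x))
      ≡⟨ cong -_ (trans (sym (ℤₚ.+-assoc (- S) S (ν x)))
                        (trans (cong (_+ ν x) (ℤₚ.+-inverseˡ S)) (ℤₚ.+-identityˡ (ν x)))) ⟩
    - ν x ∎
    where
    step : Elt p → ℤ
    step = mobiusStep (suc k) Q (pt x) top

    S : ℤ
    S = ∑ L (λ w → [ ltV x w ] * ν w)

    step-pt : ∀ {w} → w ∈ L → step (pt w) ≡ - ([ ltV x w ] * ν w)
    step-pt {w} w∈L with ltV x w in x<w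
    ... | false = refl
    ... | true  = trans (mobiusFuel-top k w∈L descent) (cong -_ (sym (ℤₚ.*-identityˡ (ν w))))
      where
      descent : count (ltV w) L ℕ.< k
      descent = ℕₚ.<-≤-trans
        (count-< (ltV w) (ltV x) (λ v → ltV-trans x w v x<w′) w∈L x<w′ (ltV-irrefl w))
        (ℕₚ.≤-pred bound)
        where
        x<w′ : T (ltV x w)
        x<w′ = Equivalence.from T-≡ x<w

  muPoly-unique : {x : Vec ℕ p} → x ∈ L → muPoly L x ≡ ν x
  muPoly-unique {x} x∈L = begin
    - mobiusFuel (length Q) Q (pt x) top
      ≡⟨ cong (λ k → - mobiusFuel k Q (pt x) top) (length-elements L) ⟩
    - mobiusFuel (suc (length L)) Q (pt x) top
      ≡⟨ cong -_ (mobiusFuel-top (length L) x∈L fuel) ⟩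
    - - ν x
      ≡⟨ ℤₚ.neg-involutive (ν x) ⟩
    ν x ∎
    where
    fuel : count (ltV x) L ℕ.< length L
    fuel = subst (count (ltV x) L ℕ.<_) (count-true L)
                 (count-< (ltV x) (λ _ → true) (λ _ _ → _) x∈L _ (ltV-irrefl x))

Box≡Mob : {L : List (Vec ℕ p)} → Unique L → DownClosed L → (m : Vec ℕ p) → Box L m ≡ Mob L m
Box≡Mob {L = L} unique closed m = sym (begin
  Mob L m                                ≡⟨ sumPoly≡∑ (λ n → monomial (muPoly L n) n) L m ⟩
  ∑ L (λ n → monomial (muPoly L n) n m)  ≡⟨ ∑-cong L (λ {n} n∈L → monomial≡ n∈L) ⟩
  ∑ L (λ n → [ eqV n m ] * Box L n)      ≡⟨ sift (any? (Vecₚ.≡-dec ℕ._≟_ m) L) ⟩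
  Box L m                                ∎)
  where
  monomial≡ : ∀ {n} → n ∈ L → monomial (muPoly L n) n m ≡ [ eqV n m ] * Box L n
  monomial≡ {n} n∈L = trans (if-then-else≡[]* (eqV n m) (muPoly L n))
    (cong ([ eqV n m ] *_) (muPoly-unique unique (Box L) (∑-upper-Box unique closed) n∈L))

  sift : Dec (m ∈ L) → ∑ L (λ n → [ eqV n m ] * Box L n) ≡ Box L m
  sift (yes m∈L) = ∑-[eqV]-∈ (Box L) unique m∈L
  sift (no  m∉L) = trans (∑-[eqV]-∉ L (Box L) m∉L) (sym (Box-∉ unique closed m∉L))

theorem3p3 : (p : ℕ) (P : List (Vec ℕ p)) → IsPolymatroid P →
    (L : List (Vec ℕ p)) → Enumerates P L →
    (m : Vec ℕ p) → Box L m ≡ Mob L m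
theorem3p3 p P _ L enumerates = Box≡Mob (proj₁ enumerates) (Enumerates⇒DownClosed enumerates)
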